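{- Let $\mathcal C$ be an intersection-complete neural code and $\mathcal I\subseteq\mathcal C$ an isolated subset with minimal element $\mu$. Then $\{\mu\}\cup(\mathcal C\setminus\mathcal I)$ is intersection-complete.
   Context: A neural code is a set $\mathcal C\subseteq 2^{[n]}$ containing $\varnothing$. A code is intersection-complete if $\sigma\cap\tau\in\mathcal C$ for all $\sigma,\tau\in\mathcal C$. If $\mathcal C$ is intersection-complete, a subset $\mathcal I\subseteq\mathcal C$ is isolated if it is nonempty and closed under pairwise intersection (so it has a least element $\mu$, its minimal element), and there are no $\sigma\in\mathcal C\setminus\mathcal I$ and $\tau\in\mathcal I\setminus\{\mu\}$ with $\tau\subseteq\sigma$. -}

module Defs where

open import Level using (0ℓ)
open import Data.Nat using (ℕ)
open import Data.Fin.Subset using (Subset; ⊥; _∩_; _⊆_)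
open import Data.Product using (_×_; ∃)
open import Data.Sum using (_⊎_)
open import Relation.Nullary using (¬_)
open import Relation.Binary.PropositionalEquality using (_≡_)

Family : ℕ → Set₁
Family n = Subset n → Set

record NeuralCode (n : ℕ) (C : Family n) : Set where
  field
    hasEmpty : C ⊥

IntersectionClosed : ∀ {n} → Family n → Set
IntersectionClosed {n} F = ∀ (σ τ : Subset n) → F σ → F τ → F (σ ∩ τ)

IntersectionComplete : ∀ {n} → Family n → Set
IntersectionComplete C = NeuralCode _ C × IntersectionClosed C

IsMinimalElement : ∀ {n} → Family n → Subset n → Set
IsMinimalElement {n} I μ = I μ × (∀ (τ : Subset n) → I τ → μ ⊆ τ)

SubFamily : ∀ {n} → Family n → Family n → Set
SubFamily {n} I C = ∀ (σ : Subset n) → I σ → C σ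

record Isolated {n} (C I : Family n) (μ : Subset n) : Set where
  field
    sub       : SubFamily I C
    closed    : IntersectionClosed I
    minimal   : IsMinimalElement I μ
    isolation : ∀ (σ τ : Subset n) → C σ → ¬ I σ → I τ → ¬ (τ ≡ μ) → ¬ (τ ⊆ σ)

MuUnionComplement : ∀ {n} → Family n → Family n → Subset n → Family n
MuUnionComplement C I μ σ = (σ ≡ μ) ⊎ (C σ × ¬ I σ)

{-# OPTIONS --safe #-}
module Submission where

open import Defs
open import Data.Nat using (ℕ)
open import Data.Fin.Subset using (Subset; _⊆_) renaming (⊥ to ∅)
open import Data.Fin.Subset.Properties using (p∩q⊆p; p∩q⊆q; ⊆-antisym; ⊥⊆; ∩-idem)
open import Data.Vec.Properties using (≡-dec)
open import Data.Bool.Properties using (_≟_)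
open import Data.Product using (_,_; proj₁; proj₂)
open import Data.Sum using (inj₁; inj₂)
open import Relation.Nullary using (yes; no; ¬_)
open import Relation.Binary.PropositionalEquality using (_≡_; refl)

-- A codeword of C lying below some σ ∈ C \ I is either μ or outside I, by
-- isolation. The intersection of two members of {μ} ∪ (C \ I) is a codeword of C
-- lying below whichever factor is in C \ I, and μ ∩ μ = μ.
module _ {n : ℕ} {C I : Family n} {μ : Subset n} where

  MuUnionComplement-intro : ∀ {ρ} → C ρ → (¬ ρ ≡ μ → ¬ I ρ) → MuUnionComplement C I μ ρ
  MuUnionComplement-intro {ρ} cρ ρ≢μ⇒ρ∉I with ≡-dec _≟_ ρ μ
  ... | yes ρ≡μ = inj₁ ρ≡μ
  ... | no  ρ≢μ = inj₂ (cρ , ρ≢μ⇒ρ∉I ρ≢μ)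

  MuUnionComplement⊆C : Isolated C I μ → SubFamily (MuUnionComplement C I μ) C
  MuUnionComplement⊆C iso _ (inj₁ refl)     = Isolated.sub iso μ (proj₁ (Isolated.minimal iso))
  MuUnionComplement⊆C iso _ (inj₂ (cσ , _)) = cσ

  MuUnionComplement-⊆-complement : Isolated C I μ → ∀ {ρ σ} → C ρ → C σ → ¬ I σ → ρ ⊆ σ →
                                   MuUnionComplement C I μ ρ
  MuUnionComplement-⊆-complement iso {ρ} {σ} cρ cσ σ∉I ρ⊆σ =
    MuUnionComplement-intro cρ λ ρ≢μ ρ∈I → Isolated.isolation iso σ ρ cσ σ∉I ρ∈I ρ≢μ ρ⊆σ

  MuUnionComplement-∅ : NeuralCode n C → Isolated C I μ → MuUnionComplement C I μ ∅
  MuUnionComplement-∅ code iso = MuUnionComplement-intro (NeuralCode.hasEmpty code)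
    λ ∅≢μ ∅∈I → ∅≢μ (⊆-antisym ⊥⊆ (proj₂ (Isolated.minimal iso) ∅ ∅∈I))

  MuUnionComplement-∩-closed : IntersectionClosed C → Isolated C I μ →
                               IntersectionClosed (MuUnionComplement C I μ)
  MuUnionComplement-∩-closed C-closed iso σ τ (inj₁ refl) (inj₁ refl) = inj₁ (∩-idem σ)
  MuUnionComplement-∩-closed C-closed iso σ τ σ∈ (inj₂ (cτ , τ∉I)) =
    MuUnionComplement-⊆-complement iso (C-closed σ τ (MuUnionComplement⊆C iso σ σ∈) cτ) cτ τ∉I (p∩q⊆q σ τ)
  MuUnionComplement-∩-closed C-closed iso σ τ (inj₂ (cσ , σ∉I)) τ∈ =
    MuUnionComplement-⊆-complement iso (C-closed σ τ cσ (MuUnionComplement⊆C iso τ τ∈)) cσ σ∉I (p∩q⊆p σ τ)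

proposition34 : ∀ (n : ℕ) (C I : Family n) (μ : Subset n) →
    IntersectionComplete C → Isolated C I μ →
    IntersectionComplete (MuUnionComplement C I μ)
proposition34 n C I μ (code , C-closed) iso =
  record { hasEmpty = MuUnionComplement-∅ code iso } , MuUnionComplement-∩-closed C-closed iso
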